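{- Let $q\equiv 3 \pmod 4$ be an odd prime power with $q\geq 11$, and let $\beta\in NQR(q)\setminus\{ -1\}$ satisfy $\beta^2-\beta+1=0$. For $\gamma\in\mathbb{F}_q$ let $F_\gamma=\{\{\infty,\gamma\}\}\cup\{\{x+\gamma,x\beta+\gamma\}: x\in QR(q)\}$. Then the one-factorization $\{F_\gamma:\gamma\in\mathbb{F}_q\}$ of the complete graph on $\mathbb{F}_q\cup\{\infty\}$ contains a cycle of length four through $\infty$; that is, there are distinct $\gamma,\delta\in\mathbb{F}_q$ such that $F_\gamma\cup F_\delta$ contains a $4$-cycle $C_4$ with $\infty\in V(C_4)$.
   Context: For an odd prime power $q$, $QR(q)$ denotes the set of nonzero squares (quadratic residues) of $\mathbb{F}_q$ and $NQR(q)=\mathbb{F}_q^*\setminus QR(q)$ the set of non-quadratic residues. For $q\equiv 3\pmod 4$, $q\neq 3$, and $\beta\in NQR(q)\setminus\{ -1\}$, the set $S_\beta=\{\{x,x\beta\}:x\in QR(q)\}$ is a (strong) starter of $\mathbb{F}_q$, and the one-factors $F_\gamma$ above form the one-factorization of $K_{q+1}$ (on vertex set $\mathbb{F}_q\cup\{\infty\}$) generated by $S_\beta$. The union of two distinct one-factors is a disjoint union of even cycles. -}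

module Defs where

open import Data.Nat using (ℕ)
open import Data.Fin using (Fin)
open import Data.Maybe using (Maybe; just; nothing)
open import Data.Product using (Σ; ∃; _×_; _,_)
open import Data.Sum using (_⊎_)
open import Relation.Nullary using (¬_)
open import Relation.Binary.PropositionalEquality using (_≡_; _≢_)
open import Algebra.Structures using (IsCommutativeRing)
open import Function.Bundles using (_↔_)

record FiniteField (q : ℕ) : Set₁ where
  infixl 6 _+_
  infixl 7 _*_
  field
    F   : Set
    _+_ : F → F → F
    _*_ : F → F → F
    -_  : F → F
    0#  : F
    1#  : F
    isCommutativeRing : IsCommutativeRing _≡_ _+_ _*_ -_ 0# 1#
    0≢1 : 0# ≢ 1#
    inverse : (x : F) → x ≢ 0# → Σ F (λ y → x * y ≡ 1#)
    enumeration : F ↔ Fin q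

  QR : F → Set
  QR x = x ≢ 0# × ∃ (λ y → y * y ≡ x)

  NQR : F → Set
  NQR x = x ≢ 0# × ¬ QR x

  -- vertex set F_q ∪ {∞}; nothing = ∞
  Vertex : Set
  Vertex = Maybe F

  InFactor : F → F → Vertex → Vertex → Set
  InFactor β γ u v =
      (u ≡ nothing × v ≡ just γ)
    ⊎ (u ≡ just γ × v ≡ nothing)
    ⊎ ∃ (λ x → QR x ×
         ((u ≡ just (x + γ) × v ≡ just (x * β + γ))
         ⊎ (u ≡ just (x * β + γ) × v ≡ just (x + γ))))

  InUnion : F → F → F → Vertex → Vertex → Set
  InUnion β γ δ u v = InFactor β γ u v ⊎ InFactor β δ u v

  HasC4Through∞ : F → F → F → Set
  HasC4Through∞ β γ δ =
    ∃ λ v₁ → ∃ λ v₂ → ∃ λ v₃ →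
      (nothing ≢ v₁ × nothing ≢ v₂ × nothing ≢ v₃ × v₁ ≢ v₂ × v₁ ≢ v₃ × v₂ ≢ v₃)
      × InUnion β γ δ nothing v₁ × InUnion β γ δ v₁ v₂
      × InUnion β γ δ v₂ v₃ × InUnion β γ δ v₃ nothing

-- A root β of x² − x + 1 is a primitive sixth root of unity, so β³ = −1 and
-- −β = β⁴ = (β²)² is a nonzero square. The translate F_β of the starter then
-- contains the edge {−β + β, −β·β + β} = {0, 1}, while F_0 contains {1, β}; together
-- with the edges {∞, 0} ∈ F_0 and {β, ∞} ∈ F_β this closes the 4-cycle ∞ 0 1 β.
-- The vertices are distinct because 1 is a square and β is not.
module Submission where

open import Defs
open import Data.Nat using (ℕ; suc; _≤_; _^_; _%_)
open import Data.Nat.Primality using (Prime)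
open import Data.Product using (∃; _×_; _,_)
open import Data.Sum using (inj₁; inj₂)
open import Data.Maybe using (just; nothing)
open import Data.Maybe.Properties using (just-injective)
open import Relation.Binary.PropositionalEquality using (_≡_; _≢_)
import Relation.Binary.PropositionalEquality as ≡
open import Algebra.Bundles using (CommutativeRing)
open import Algebra.Structures using (IsCommutativeRing)

module SixthRootOfUnity {c ℓ} (R : CommutativeRing c ℓ) where
  open CommutativeRing R
  open import Algebra.Properties.Group +-group using (inverseˡ-unique; ⁻¹-injective; ε⁻¹≈ε)
  open import Relation.Binary.Reasoning.Setoid setoid
  open import Algebra.Solver.Ring.NaturalCoefficients.Default commutativeSemiring
    using (solve; _:=_; _:+_; _:*_; con)

  -x≈0⇒x≈0 : ∀ {x} → - x ≈ 0# → x ≈ 0#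
  -x≈0⇒x≈0 -x≈0 = ⁻¹-injective (trans -x≈0 (sym ε⁻¹≈ε))

  -- In the two identities below y stands for −x, and the error term carries the factor
  -- x + y; this keeps them commutative-semiring identities, which the solver decides.
  x⁴+x-factorisation : ∀ x y → (x * x + y + 1#) * (x * x + x) ≈ x * x * (x * x) + x + (x + y) * (x * x + x)
  x⁴+x-factorisation = solve 2 (λ x y →
    (x :* x :+ y :+ con 1) :* (x :* x :+ x) := x :* x :* (x :* x) :+ x :+ (x :+ y) :* (x :* x :+ x)) refl

  yx+x-rearrangement : ∀ x y → y * x + x + (x * x + y + 1#) ≈ 1# + (x + y) * (x + 1#)
  yx+x-rearrangement = solve 2 (λ x y →
    y :* x :+ x :+ (x :* x :+ y :+ con 1) := con 1 :+ (x :+ y) :* (x :+ con 1)) refl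

  x+[y-y]*z≈x : ∀ x y z → x + (y + - y) * z ≈ x
  x+[y-y]*z≈x x y z = begin
    x + (y + - y) * z  ≈⟨ +-congˡ (*-congʳ (-‿inverseʳ y)) ⟩
    x + 0# * z         ≈⟨ +-congˡ (zeroˡ z) ⟩
    x + 0#             ≈⟨ +-identityʳ x ⟩
    x                  ∎

  module _ {x : Carrier} (root : x * x + - x + 1# ≈ 0#) where

    x⁴≈-x : x * x * (x * x) ≈ - x
    x⁴≈-x = inverseˡ-unique _ x (begin
      x * x * (x * x) + x                             ≈⟨ x+[y-y]*z≈x _ x _ ⟨
      x * x * (x * x) + x + (x + - x) * (x * x + x)   ≈⟨ x⁴+x-factorisation x (- x) ⟨
      (x * x + - x + 1#) * (x * x + x)                ≈⟨ *-congʳ root ⟩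
      0# * (x * x + x)                                ≈⟨ zeroˡ _ ⟩
      0#                                              ∎)

    -x*x+x≈1 : - x * x + x ≈ 1#
    -x*x+x≈1 = begin
      - x * x + x                         ≈⟨ +-identityʳ _ ⟨
      - x * x + x + 0#                    ≈⟨ +-congˡ root ⟨
      - x * x + x + (x * x + - x + 1#)    ≈⟨ yx+x-rearrangement x (- x) ⟩
      1# + (x + - x) * (x + 1#)           ≈⟨ x+[y-y]*z≈x 1# x _ ⟩
      1#                                  ∎

module _ {q : ℕ} (𝔽 : FiniteField q) where
  open FiniteField 𝔽
  open ≡ using (refl; sym; trans; cong; subst)
  open IsCommutativeRing isCommutativeRing using (+-identityʳ; *-identityˡ; -‿inverseˡ)

  commutativeRing : CommutativeRing _ _
  commutativeRing = record { isCommutativeRing = isCommutativeRing }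

  open SixthRootOfUnity commutativeRing

  1#∈QR : QR 1#
  1#∈QR = (λ 1≡0 → 0≢1 (sym 1≡0)) , 1# , *-identityˡ 1#

  -root∈QR : ∀ {β} → β ≢ 0# → β * β + - β + 1# ≡ 0# → QR (- β)
  -root∈QR {β} β≢0 root = (λ -β≡0 → β≢0 (-x≈0⇒x≈0 -β≡0)) , β * β , x⁴≈-x root

  c4-∞01β : ∀ {β} → NQR β → QR (- β) → - β * β + β ≡ 1# → HasC4Through∞ β 0# β
  c4-∞01β {β} (β≢0 , β∉QR) -β∈QR -β*β+β≡1 =
      just 0# , just 1# , just β
    , ( (λ ()) , (λ ()) , (λ ())
      , (λ 0≡1 → 0≢1 (just-injective 0≡1))
      , (λ 0≡β → β≢0 (sym (just-injective 0≡β)))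
      , (λ 1≡β → β∉QR (subst QR (just-injective 1≡β) 1#∈QR)) )
    , ∞0∈F₀ , 01∈Fβ , 1β∈F₀ , β∞∈Fβ
    where
    ∞0∈F₀ : InUnion β 0# β nothing (just 0#)
    ∞0∈F₀ = inj₁ (inj₁ (refl , refl))

    01∈Fβ : InUnion β 0# β (just 0#) (just 1#)
    01∈Fβ = inj₂ (inj₂ (inj₂ (- β , -β∈QR ,
      inj₁ (cong just (sym (-‿inverseˡ β)) , cong just (sym -β*β+β≡1)))))

    1β∈F₀ : InUnion β 0# β (just 1#) (just β)
    1β∈F₀ = inj₁ (inj₂ (inj₂ (1# , 1#∈QR ,
      inj₁ (cong just (sym (+-identityʳ 1#)) , cong just (sym (trans (+-identityʳ _) (*-identityˡ β)))))))

    β∞∈Fβ : InUnion β 0# β (just β) nothing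
    β∞∈Fβ = inj₂ (inj₂ (inj₁ (refl , refl)))

mainTheorem1 : (q : ℕ) → (𝔽 : FiniteField q) →
    (∃ λ p → ∃ λ k → Prime p × q ≡ p ^ suc k) → q % 4 ≡ 3 → 11 ≤ q →
    (β : FiniteField.F 𝔽) → FiniteField.NQR 𝔽 β → β ≢ FiniteField.-_ 𝔽 (FiniteField.1# 𝔽) →
    FiniteField._+_ 𝔽 (FiniteField._+_ 𝔽 (FiniteField._*_ 𝔽 β β) (FiniteField.-_ 𝔽 β)) (FiniteField.1# 𝔽) ≡ FiniteField.0# 𝔽 →
    ∃ λ γ → ∃ λ δ → γ ≢ δ × FiniteField.HasC4Through∞ 𝔽 β γ δ
mainTheorem1 q 𝔽 _ _ _ β β∈NQR@(β≢0 , _) _ root =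
  0# , β , (λ 0≡β → β≢0 (≡.sym 0≡β)) ,
  c4-∞01β 𝔽 β∈NQR (-root∈QR 𝔽 β≢0 root) (-x*x+x≈1 root)
  where open FiniteField 𝔽
        open SixthRootOfUnity (commutativeRing 𝔽)
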